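{- Let $k\ge 3$ and let $R\subset\{0,1\}^n$ be a relation with $0^n\notin R$. Call a tuple $\chi_S^n$ ($S\subseteq[n]$) minimal in $R$ if $\chi_S^n\in R$ but $\chi_{S'}^n\notin R$ for every proper subset $S'\subsetneq S$. For $i\in[n]$ let $\mathcal F_i$ be the family of sets $S$ with $|S|=i$ such that $\chi_S^n$ is minimal in $R$. If $R$ is preserved by the partial $k$-NU operation $n_k$, then no $\mathcal F_i$ contains a sunflower of $k$ sets.
   Context: For $S\subseteq[n]$, $\chi_S^n\in\{0,1\}^n$ is the tuple with $\chi_S^n[i]=1$ iff $i\in S$. A sunflower of $k$ sets is a family of $k$ distinct sets $S_1,\dots,S_k$ with $S_i\cap S_j=S_1\cap\dots\cap S_k$ for all $i\neq j$. The partial $k$-NU operation $n_k$ is the $k$-ary partial operation on $\{0,1\}$ defined exactly on tuples with all but at most one coordinate equal to some $x$, with value $x$; applied coordinatewise (defined iff defined in every coordinate); $R$ is preserved if every defined application of $n_k$ to tuples of $R$ lies in $R$. -}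

module Defs where

open import Data.Nat using (ℕ)
open import Data.Bool using (Bool)
open import Data.Fin using (Fin)
open import Data.Fin.Subset using (Subset; _⊂_; _∩_; ⋂; ∣_∣)
open import Data.Vec using (lookup)
open import Data.List using (tabulate)
open import Data.Product using (Σ; _×_)
open import Relation.Binary.PropositionalEquality using (_≡_; _≢_)
open import Relation.Nullary using (¬_)

-- A tuple χ_S^n ∈ {0,1}^n is represented by S : Subset n = Vec Bool n
-- (lookup S i ≡ true iff i ∈ S).  A relation R ⊆ {0,1}^n is a predicate.
Relation : ℕ → Set₁
Relation n = Subset n → Set

-- Partial k-NU operation n_k on {0,1}: defined on b exactly when all but at
-- most one coordinate equal some x, and then its value is x.
-- NUval k b x  means "n_k(b) is defined and equals x".
NUval : (k : ℕ) → (Fin k → Bool) → Bool → Set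
NUval k b x = Σ (Fin k) λ j → ∀ i → i ≢ j → b i ≡ x

NUapp : ∀ {n} (k : ℕ) → (Fin k → Subset n) → Subset n → Set
NUapp k t r = ∀ c → NUval k (λ j → lookup (t j) c) (lookup r c)

Preserves : ∀ {n} (k : ℕ) → Relation n → Set
Preserves k R = ∀ t r → (∀ j → R (t j)) → NUapp k t r → R r

Minimal : ∀ {n} → Relation n → Subset n → Set
Minimal R S = R S × (∀ S′ → S′ ⊂ S → ¬ R S′)

InFamily : ∀ {n} → Relation n → ℕ → Subset n → Set
InFamily R i S = ∣ S ∣ ≡ i × Minimal R S

Sunflower : ∀ {n} (k : ℕ) → (Fin k → Subset n) → Set
Sunflower k S =
  (∀ i j → i ≢ j → S i ≢ S j) ×
  (∀ i j → i ≢ j → S i ∩ S j ≡ ⋂ (tabulate S))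

-- Applying n_k to the petals of a sunflower yields its kernel: in a coordinate
-- lying in some petal, every other petal agrees with the kernel there, and a
-- coordinate lying in no petal is 0 everywhere.  So the kernel is in R, and it
-- is contained in each petal; minimality then forces any two petals to equal the
-- kernel, contradicting that they are distinct.
module Submission where

open import Defs
open import Data.Nat using (ℕ; _≤_; s≤s; suc)
open import Data.Fin using (Fin; zero; suc)
open import Data.Fin.Properties using (any?)
open import Data.Fin.Subset using (Subset; ⊥; _∩_; _⊆_)
open import Data.Fin.Subset.Properties using (_∈?_; ⊆-antisym; ⊆-trans; p∩q⊆p; p∩q⊆q)
open import Data.Product using (Σ; _×_; _,_; proj₁; proj₂)
open import Data.Bool using (true; false; _∧_; _≟_)
open import Data.Bool.Properties using (∧-identityʳ; ¬-not)
open import Data.Vec using (lookup)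
open import Data.Vec.Properties using (lookup-zipWith)
open import Relation.Nullary using (¬_; yes; no; contradiction)
open import Relation.Binary.PropositionalEquality using (_≡_; _≢_; sym; trans; cong; module ≡-Reasoning)

lookup-∩ : ∀ {n} (p q : Subset n) c → lookup (p ∩ q) c ≡ lookup p c ∧ lookup q c
lookup-∩ p q c = lookup-zipWith _∧_ c p q

NUapp-pairwise-∩ : ∀ {k n} (S : Fin k → Subset n) (K : Subset n) {i j : Fin k} → i ≢ j →
                   (∀ a b → a ≢ b → S a ∩ S b ≡ K) → NUapp k S K
NUapp-pairwise-∩ S K {i} {j} i≢j pairwise c with any? (λ b → lookup (S b) c ≟ true)
... | yes (b , c∈Sb) = b , λ a a≢b → begin
  lookup (S a) c                   ≡⟨ sym (∧-identityʳ _) ⟩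
  lookup (S a) c ∧ true            ≡⟨ cong (lookup (S a) c ∧_) (sym c∈Sb) ⟩
  lookup (S a) c ∧ lookup (S b) c  ≡⟨ sym (lookup-∩ (S a) (S b) c) ⟩
  lookup (S a ∩ S b) c             ≡⟨ cong (λ p → lookup p c) (pairwise a b a≢b) ⟩
  lookup K c                       ∎
  where open ≡-Reasoning
... | no c∉⋃S = i , λ a _ → begin
  lookup (S a) c                   ≡⟨ outside a ⟩
  false                            ≡⟨ cong (_∧ lookup (S j) c) (sym (outside i)) ⟩
  lookup (S i) c ∧ lookup (S j) c  ≡⟨ sym (lookup-∩ (S i) (S j) c) ⟩
  lookup (S i ∩ S j) c             ≡⟨ cong (λ p → lookup p c) (pairwise i j i≢j) ⟩
  lookup K c                       ∎
  where
  open ≡-Reasoning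
  outside : ∀ a → lookup (S a) c ≡ false
  outside a = ¬-not (λ c∈Sa → c∉⋃S (a , c∈Sa))

minimal-⊆ : ∀ {n} {R : Relation n} {S T : Subset n} → Minimal R S → R T → T ⊆ S → S ⊆ T
minimal-⊆ {T = T} (_ , no-smaller) RT T⊆S {x} x∈S with x ∈? T
... | yes x∈T = x∈T
... | no x∉T = contradiction RT (no-smaller T (T⊆S , x , x∈S , x∉T))

minimal-∩-≡ : ∀ {n} {R : Relation n} {S T : Subset n} →
              Minimal R S → Minimal R T → R (S ∩ T) → S ≡ T
minimal-∩-≡ {S = S} {T} minS minT R∩ = ⊆-antisym
  (⊆-trans (minimal-⊆ minS R∩ (p∩q⊆p S T)) (p∩q⊆q S T))
  (⊆-trans (minimal-⊆ minT R∩ (p∩q⊆q S T)) (p∩q⊆p S T))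

lemma18 : (k n : ℕ) → 3 ≤ k → (R : Relation n) → ¬ R ⊥ → Preserves k R →
          (i : ℕ) → 1 ≤ i → i ≤ n →
          ¬ (Σ (Fin k → Subset n) λ S → Sunflower k S × (∀ j → InFamily R i (S j)))
lemma18 k@(suc (suc (suc _))) n (s≤s (s≤s (s≤s _))) R _ preserves _ _ _ (S , (distinct , core) , family) =
  distinct zero one 0≢1 (minimal-∩-≡ (minimal zero) (minimal one) kernel∈R)
  where
  one : Fin k
  one = suc zero
  0≢1 : zero ≢ one
  0≢1 ()
  minimal : ∀ j → Minimal R (S j)
  minimal j = proj₂ (family j)
  pairwise : ∀ a b → a ≢ b → S a ∩ S b ≡ S zero ∩ S one
  pairwise a b a≢b = trans (core a b a≢b) (sym (core zero one 0≢1))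
  kernel∈R : R (S zero ∩ S one)
  kernel∈R = preserves S _ (λ j → proj₁ (minimal j)) (NUapp-pairwise-∩ S _ 0≢1 pairwise)
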